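{- Let $g$ be a non-negative integer and let $G$ be a connected graph of order $n$ with $e(G)$ edges. If $G$ has at least one $R_g$-cutset, then $$0\leq g\leq \left\lfloor \frac{n-3}{2}\right\rfloor \qquad\text{and}\qquad e(G)\leq \binom{n}{2}-(g+1)^2.$$
   Context: All graphs are finite and simple. A set $S\subseteq V(G)$ is a cutset of $G$ if $G-S$ is not connected. For a non-negative integer $g$, a cutset $S$ is an $R_g$-cutset if every connected component of $G-S$ has at least $g+1$ vertices. If $G$ has an $R_g$-cutset, $\kappa_g(G)$ (the $g$-extra connectivity) is the minimum cardinality of an $R_g$-cutset. -}

module Defs where

open import Data.Nat using (ℕ; suc; _+_; _≤_)
open import Data.Bool using (Bool; true; false; _∧_; if_then_else_)
open import Data.Fin using (Fin; toℕ)
open import Data.Fin.Properties using (_<?_)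
open import Data.Fin.Subset using (Subset; _∈_; _∉_; ⊥)
open import Data.List using (List; map; length)
open import Data.Nat.ListAction using (sum)
open import Data.List.Base using (allFin)
open import Data.List.Relation.Unary.All using (All)
open import Data.List.Relation.Unary.Unique.Propositional using (Unique)
open import Data.Product using (Σ; _×_; ∃)
open import Relation.Binary.PropositionalEquality using (_≡_)
open import Relation.Nullary using (¬_; does)

record Graph (n : ℕ) : Set where
  field
    adj   : Fin n → Fin n → Bool
    sym   : ∀ i j → adj i j ≡ adj j i
    irref : ∀ i → adj i i ≡ false
open Graph public

Adj : ∀ {n} → Graph n → Fin n → Fin n → Set
Adj G u v = adj G u v ≡ true

edgeCount : ∀ {n} → Graph n → ℕ
edgeCount {n} G =
  sum (map (λ i → sum (map (λ j → if does (i <? j) ∧ adj G i j then 1 else 0)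
                           (allFin n)))
           (allFin n))

-- Reach G S u v : there is a walk from u to v in G - S
-- (all vertices of the walk lie outside S).
data Reach {n : ℕ} (G : Graph n) (S : Subset n) (u : Fin n) : Fin n → Set where
  here : u ∉ S → Reach G S u u
  step : ∀ {w v} → Reach G S u w → Adj G w v → v ∉ S → Reach G S u v

Connected : ∀ {n} → Graph n → Set
Connected {n} G = ∀ (u v : Fin n) → Reach G ⊥ u v

IsCutset : ∀ {n} → Graph n → Subset n → Set
IsCutset {n} G S = Σ (Fin n) λ u → Σ (Fin n) λ v → u ∉ S × v ∉ S × ¬ Reach G S u v

-- The component of G - S containing v has at least k vertices:
-- there is a list of k distinct vertices all reachable from v in G - S.
ComponentAtLeast : ∀ {n} → Graph n → Subset n → Fin n → ℕ → Set
ComponentAtLeast {n} G S v k =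
  Σ (List (Fin n)) λ xs → length xs ≡ k × Unique xs × All (Reach G S v) xs

IsRgCutset : ∀ {n} → ℕ → Graph n → Subset n → Set
IsRgCutset {n} g G S =
  IsCutset G S × (∀ (v : Fin n) → v ∉ S → ComponentAtLeast G S v (suc g))

-- Let the R_g-cutset T separate u from v, and let A and B be g+1 vertices of the components
-- of u and of v in G - T. Then A and B are disjoint and no edge joins them, and T is nonempty
-- because G is connected; hence n ≥ 1 + 2(g+1), and the (g+1)² pairs of A × B are all
-- non-edges, so e(G) ≤ C(n,2) - (g+1)².

module Submission where

open import Defs
open import Data.Nat using (ℕ; zero; suc; _+_; _*_; _∸_; _^_; _≤_; _<_; z≤n; s≤s)
open import Data.Nat.Properties
  using (≤-trans; ≤-reflexive; +-mono-≤; +-monoʳ-≤; +-comm; +-identityʳ; *-comm; *-identityʳ; *-zeroʳ;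
         *-distribˡ-+; *-mono-≤; *-cancelˡ-≤; m≤m+n; m≤n+m; m+n≤o⇒n≤o; m+n≤o⇒m≤o∸n; ≤-refl; module ≤-Reasoning)
open import Data.Nat.DivMod using (_/_; m*n/n≡m; /-monoˡ-≤)
open import Data.Nat.Combinatorics using (_C_; nC1≡n; nCk+nC[k+1]≡[n+1]C[k+1])
open import Data.Nat.ListAction using (sum)
open import Data.Nat.Tactic.RingSolver using (solve-∀)
open import Data.Fin using (Fin) renaming (zero to fzero; suc to fsuc; _<_ to _<ᶠ_)
open import Data.Fin.Properties using (_≟_; _<?_; <-cmp)
open import Data.Fin.Subset using (Subset) renaming (_∈_ to _∈ₛ_; _∉_ to _∉ₛ_; ⊥ to ∅)
open import Data.Fin.Subset.Properties using () renaming (_∈?_ to _∈ₛ?_)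
open import Data.Bool using (true; false; _∧_; not; if_then_else_)
open import Data.List using (List; []; _∷_; map; length; allFin)
open import Data.List.Properties using (map-tabulate)
open import Data.List.Membership.Propositional using (_∈_; _∉_)
import Data.List.Membership.DecPropositional as DecMembership
open import Data.List.Relation.Unary.All using (All; lookup)
open import Data.List.Relation.Unary.Any using (here; there)
open import Data.List.Relation.Unary.Unique.Propositional using (Unique)
open import Data.List.Relation.Unary.AllPairs using ([]; _∷_)
open import Data.List.Relation.Binary.Disjoint.Propositional using (Disjoint)
open import Data.Product using (Σ; ∃; _×_; _,_)
open import Data.Sum using (_⊎_; inj₁; inj₂)
open import Data.Empty using (⊥-elim)
open import Relation.Binary.Definitions using (tri<; tri≈; tri>)
open import Relation.Binary.PropositionalEquality
  using (_≡_; _≢_; refl; trans; cong; cong₂; subst; module ≡-Reasoning) renaming (sym to ≡-sym)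
open import Relation.Nullary using (¬_; Dec; yes; no; does)
open import Relation.Nullary.Decidable using (dec-true; _×-dec_)

_∈?_ : ∀ {n} (x : Fin n) (xs : List (Fin n)) → Dec (x ∈ xs)
x ∈? xs = DecMembership._∈?_ _≟_ x xs

indicator : {P : Set} → Dec P → ℕ
indicator d = if does d then 1 else 0

indicator-× : {P Q : Set} (p? : Dec P) (q? : Dec Q) → indicator (p? ×-dec q?) ≡ indicator p? * indicator q?
indicator-× (yes _) (yes _) = refl
indicator-× (yes _) (no _) = refl
indicator-× (no _) _ = refl

∑ : (n : ℕ) → (Fin n → ℕ) → ℕ
∑ n f = sum (map f (allFin n))

∑-suc : ∀ n (f : Fin (suc n) → ℕ) → ∑ (suc n) f ≡ f fzero + ∑ n (λ i → f (fsuc i))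
∑-suc n f = cong (λ xs → f fzero + sum xs)
  (trans (map-tabulate fsuc f) (≡-sym (map-tabulate (λ i → i) (λ i → f (fsuc i)))))

∑-cong : ∀ n {f h : Fin n → ℕ} → (∀ i → f i ≡ h i) → ∑ n f ≡ ∑ n h
∑-cong zero f≗h = refl
∑-cong (suc n) {f} {h} f≗h = begin
  ∑ (suc n) f                       ≡⟨ ∑-suc n f ⟩
  f fzero + ∑ n (λ i → f (fsuc i))  ≡⟨ cong₂ _+_ (f≗h fzero) (∑-cong n (λ i → f≗h (fsuc i))) ⟩
  h fzero + ∑ n (λ i → h (fsuc i))  ≡⟨ ∑-suc n h ⟨
  ∑ (suc n) h                       ∎
  where open ≡-Reasoning

∑-mono-≤ : ∀ n {f h : Fin n → ℕ} → (∀ i → f i ≤ h i) → ∑ n f ≤ ∑ n h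
∑-mono-≤ zero f≤h = z≤n
∑-mono-≤ (suc n) {f} {h} f≤h = begin
  ∑ (suc n) f                       ≡⟨ ∑-suc n f ⟩
  f fzero + ∑ n (λ i → f (fsuc i))  ≤⟨ +-mono-≤ (f≤h fzero) (∑-mono-≤ n (λ i → f≤h (fsuc i))) ⟩
  h fzero + ∑ n (λ i → h (fsuc i))  ≡⟨ ∑-suc n h ⟨
  ∑ (suc n) h                       ∎
  where open ≤-Reasoning

∑-const : ∀ n c → ∑ n (λ _ → c) ≡ n * c
∑-const zero c = refl
∑-const (suc n) c = trans (∑-suc n (λ _ → c)) (cong (c +_) (∑-const n c))

∑-distrib-+ : ∀ n (f h : Fin n → ℕ) → ∑ n (λ i → f i + h i) ≡ ∑ n f + ∑ n h
∑-distrib-+ zero f h = refl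
∑-distrib-+ (suc n) f h = begin
  ∑ (suc n) (λ i → f i + h i)                                              ≡⟨ ∑-suc n _ ⟩
  (f fzero + h fzero) + ∑ n (λ i → f (fsuc i) + h (fsuc i))                ≡⟨ cong (f fzero + h fzero +_) (∑-distrib-+ n _ _) ⟩
  (f fzero + h fzero) + (∑ n (λ i → f (fsuc i)) + ∑ n (λ i → h (fsuc i)))  ≡⟨ interchange (f fzero) (h fzero) _ _ ⟩
  (f fzero + ∑ n (λ i → f (fsuc i))) + (h fzero + ∑ n (λ i → h (fsuc i)))  ≡⟨ cong₂ _+_ (∑-suc n f) (∑-suc n h) ⟨
  ∑ (suc n) f + ∑ (suc n) h                                                ∎
  where
  open ≡-Reasoning
  interchange : ∀ a b c d → (a + b) + (c + d) ≡ (a + c) + (b + d)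
  interchange = solve-∀

∑-distribˡ-* : ∀ n c (f : Fin n → ℕ) → ∑ n (λ i → c * f i) ≡ c * ∑ n f
∑-distribˡ-* zero c f = ≡-sym (*-comm c 0)
∑-distribˡ-* (suc n) c f = begin
  ∑ (suc n) (λ i → c * f i)                    ≡⟨ ∑-suc n _ ⟩
  c * f fzero + ∑ n (λ i → c * f (fsuc i))     ≡⟨ cong (c * f fzero +_) (∑-distribˡ-* n c _) ⟩
  c * f fzero + c * ∑ n (λ i → f (fsuc i))     ≡⟨ *-distribˡ-+ c (f fzero) _ ⟨
  c * (f fzero + ∑ n (λ i → f (fsuc i)))       ≡⟨ cong (c *_) (∑-suc n f) ⟨
  c * ∑ (suc n) f                              ∎
  where open ≡-Reasoning

∑-comm : ∀ m n (f : Fin m → Fin n → ℕ) → ∑ m (λ i → ∑ n (f i)) ≡ ∑ n (λ j → ∑ m (λ i → f i j))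
∑-comm zero n f = ≡-sym (trans (∑-const n 0) (*-zeroʳ n))
∑-comm (suc m) n f = begin
  ∑ (suc m) (λ i → ∑ n (f i))                                  ≡⟨ ∑-suc m _ ⟩
  ∑ n (f fzero) + ∑ m (λ i → ∑ n (f (fsuc i)))                 ≡⟨ cong (∑ n (f fzero) +_) (∑-comm m n _) ⟩
  ∑ n (f fzero) + ∑ n (λ j → ∑ m (λ i → f (fsuc i) j))         ≡⟨ ∑-distrib-+ n _ _ ⟨
  ∑ n (λ j → f fzero j + ∑ m (λ i → f (fsuc i) j))             ≡⟨ ∑-cong n (λ j → ∑-suc m (λ i → f i j)) ⟨
  ∑ n (λ j → ∑ (suc m) (λ i → f i j))                          ∎
  where open ≡-Reasoning

∑-indicator-≟ : ∀ n (y : Fin n) → ∑ n (λ x → indicator (x ≟ y)) ≡ 1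
∑-indicator-≟ (suc n) fzero = begin
  ∑ (suc n) (λ x → indicator (x ≟ fzero))  ≡⟨ ∑-suc n (λ x → indicator (x ≟ fzero)) ⟩
  1 + ∑ n (λ x → 0)                        ≡⟨ cong suc (trans (∑-const n 0) (*-zeroʳ n)) ⟩
  1                                        ∎
  where open ≡-Reasoning
∑-indicator-≟ (suc n) (fsuc y) = begin
  ∑ (suc n) (λ x → indicator (x ≟ fsuc y))    ≡⟨ ∑-suc n (λ x → indicator (x ≟ fsuc y)) ⟩
  ∑ n (λ x → indicator (fsuc x ≟ fsuc y))     ≡⟨ ∑-cong n (λ x → indicator-suc x) ⟩
  ∑ n (λ x → indicator (x ≟ y))               ≡⟨ ∑-indicator-≟ n y ⟩
  1                                           ∎
  where
  open ≡-Reasoning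
  indicator-suc : ∀ x → indicator (fsuc x ≟ fsuc y) ≡ indicator (x ≟ y)
  indicator-suc x with x ≟ y
  ... | yes _ = refl
  ... | no _ = refl

∑∑ : (n : ℕ) → (Fin n → Fin n → ℕ) → ℕ
∑∑ n f = ∑ n (λ i → ∑ n (f i))

∑∑-cong : ∀ n {f h : Fin n → Fin n → ℕ} → (∀ i j → f i j ≡ h i j) → ∑∑ n f ≡ ∑∑ n h
∑∑-cong n f≗h = ∑-cong n (λ i → ∑-cong n (f≗h i))

∑∑-mono-≤ : ∀ n {f h : Fin n → Fin n → ℕ} → (∀ i j → f i j ≤ h i j) → ∑∑ n f ≤ ∑∑ n h
∑∑-mono-≤ n f≤h = ∑-mono-≤ n (λ i → ∑-mono-≤ n (f≤h i))

∑∑-distrib-+ : ∀ n (f h : Fin n → Fin n → ℕ) → ∑∑ n (λ i j → f i j + h i j) ≡ ∑∑ n f + ∑∑ n h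
∑∑-distrib-+ n f h = trans (∑-cong n (λ i → ∑-distrib-+ n (f i) (h i))) (∑-distrib-+ n _ _)

∑∑-transpose : ∀ n (f : Fin n → Fin n → ℕ) → ∑∑ n (λ i j → f j i) ≡ ∑∑ n f
∑∑-transpose n f = ∑-comm n n (λ i j → f j i)

∑∑-product : ∀ n (f h : Fin n → ℕ) → ∑∑ n (λ i j → f i * h j) ≡ ∑ n f * ∑ n h
∑∑-product n f h = begin
  ∑ n (λ i → ∑ n (λ j → f i * h j))  ≡⟨ ∑-cong n (λ i → ∑-distribˡ-* n (f i) h) ⟩
  ∑ n (λ i → f i * ∑ n h)            ≡⟨ ∑-cong n (λ i → *-comm (f i) (∑ n h)) ⟩
  ∑ n (λ i → ∑ n h * f i)            ≡⟨ ∑-distribˡ-* n (∑ n h) f ⟩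
  ∑ n h * ∑ n f                      ≡⟨ *-comm (∑ n h) (∑ n f) ⟩
  ∑ n f * ∑ n h                      ∎
  where open ≡-Reasoning

∑∑-indicator-< : ∀ n → ∑∑ n (λ i j → indicator (i <? j)) ≡ n C 2
∑∑-indicator-< zero = refl
∑∑-indicator-< (suc n) = begin
  ∑∑ (suc n) (λ i j → indicator (i <? j))                          ≡⟨ ∑-suc n (λ i → ∑ (suc n) (λ j → indicator (i <? j))) ⟩
  ∑ (suc n) (λ j → indicator (fzero {n} <? j))
    + ∑ n (λ i → ∑ (suc n) (λ j → indicator (fsuc i <? j)))       ≡⟨ cong₂ _+_ (∑-suc n (λ j → indicator (fzero {n} <? j)))
                                                                                 (∑-cong n (λ i → ∑-suc n (λ j → indicator (fsuc i <? j)))) ⟩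
  ∑ n (λ _ → 1) + ∑∑ n (λ i j → indicator (i <? j))              ≡⟨ cong₂ _+_ (trans (∑-const n 1) (*-identityʳ n)) (∑∑-indicator-< n) ⟩
  n + n C 2                                                      ≡⟨ cong (_+ n C 2) (nC1≡n n) ⟨
  n C 1 + n C 2                                                  ≡⟨ nCk+nC[k+1]≡[n+1]C[k+1] n 1 ⟩
  suc n C 2                                                      ∎
  where open ≡-Reasoning

nonEdgeIndicator : ∀ {n} → Graph n → Fin n → Fin n → ℕ
nonEdgeIndicator G i j = if does (i <? j) ∧ not (adj G i j) then 1 else 0

nonEdgeCount : ∀ {n} → Graph n → ℕ
nonEdgeCount {n} G = ∑∑ n (nonEdgeIndicator G)

edgeCount+nonEdgeCount≡nC2 : ∀ {n} (G : Graph n) → edgeCount G + nonEdgeCount G ≡ n C 2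
edgeCount+nonEdgeCount≡nC2 {n} G = begin
  edgeCount G + nonEdgeCount G                                     ≡⟨ ∑∑-distrib-+ n _ _ ⟨
  ∑∑ n (λ i j → edgeIndicator i j + nonEdgeIndicator G i j)        ≡⟨ ∑∑-cong n (λ i j → split (does (i <? j)) (adj G i j)) ⟩
  ∑∑ n (λ i j → indicator (i <? j))                                ≡⟨ ∑∑-indicator-< n ⟩
  n C 2                                                            ∎
  where
  open ≡-Reasoning
  edgeIndicator : Fin n → Fin n → ℕ
  edgeIndicator i j = if does (i <? j) ∧ adj G i j then 1 else 0
  split : ∀ b a → (if b ∧ a then 1 else 0) + (if b ∧ not a then 1 else 0) ≡ (if b then 1 else 0)
  split false _ = refl
  split true true = refl
  split true false = refl

nonEdgeIndicator-< : ∀ {n} (G : Graph n) {i j} → i <ᶠ j → adj G i j ≡ false → nonEdgeIndicator G i j ≡ 1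
nonEdgeIndicator-< G {i} {j} i<j i≁j rewrite dec-true (i <? j) i<j | i≁j = refl

nonEdgeIndicator-pair : ∀ {n} (G : Graph n) {i j} → i ≢ j → adj G i j ≡ false →
  1 ≤ nonEdgeIndicator G i j + nonEdgeIndicator G j i
nonEdgeIndicator-pair G {i} {j} i≢j i≁j with <-cmp i j
... | tri< i<j _ _ = ≤-trans (≤-reflexive (≡-sym (nonEdgeIndicator-< G i<j i≁j))) (m≤m+n _ _)
... | tri≈ _ i≡j _ = ⊥-elim (i≢j i≡j)
... | tri> _ _ j<i = ≤-trans (≤-reflexive (≡-sym (nonEdgeIndicator-< G j<i (trans (Graph.sym G j i) i≁j))))
                             (m≤n+m _ _)

χ : ∀ {n} → List (Fin n) → Fin n → ℕ
χ xs x = indicator (x ∈? xs)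

∣_∣ : ∀ {n} → List (Fin n) → ℕ
∣_∣ {n} xs = ∑ n (χ xs)

χ-∷ : ∀ {n} {y : Fin n} {ys} → y ∉ ys → ∀ x → indicator (x ≟ y) + χ ys x ≤ χ (y ∷ ys) x
χ-∷ {y = y} {ys} y∉ys x with x ≟ y | x ∈? ys | x ∈? (y ∷ ys)
... | yes refl | yes x∈ys | _ = ⊥-elim (y∉ys x∈ys)
... | yes refl | no _ | yes _ = ≤-refl
... | yes refl | no _ | no x∉ = ⊥-elim (x∉ (here refl))
... | no _ | yes _ | yes _ = ≤-refl
... | no _ | yes x∈ys | no x∉ = ⊥-elim (x∉ (there x∈ys))
... | no _ | no _ | _ = z≤n

Unique⇒length≤∣∣ : ∀ {n} {xs : List (Fin n)} → Unique xs → length xs ≤ ∣ xs ∣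
Unique⇒length≤∣∣ [] = z≤n
Unique⇒length≤∣∣ {n} {y ∷ ys} (y≢ys ∷ unique) = begin
  suc (length ys)                                     ≤⟨ s≤s (Unique⇒length≤∣∣ unique) ⟩
  1 + ∣ ys ∣                                          ≡⟨ cong (_+ ∣ ys ∣) (∑-indicator-≟ n y) ⟨
  ∑ n (λ x → indicator (x ≟ y)) + ∣ ys ∣              ≡⟨ ∑-distrib-+ n _ _ ⟨
  ∑ n (λ x → indicator (x ≟ y) + χ ys x)              ≤⟨ ∑-mono-≤ n (χ-∷ (λ y∈ys → lookup y≢ys y∈ys refl)) ⟩
  ∣ y ∷ ys ∣                                          ∎
  where open ≤-Reasoning

∣A∣+∣B∣<n : ∀ {n} {A B : List (Fin n)} {w} → Disjoint A B → w ∉ A → w ∉ B → ∣ A ∣ + ∣ B ∣ < n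
∣A∣+∣B∣<n {n} {A} {B} {w} A#B w∉A w∉B = begin
  suc (∣ A ∣ + ∣ B ∣)                                          ≡⟨ cong (λ k → k + ∣ A ∣ + ∣ B ∣) (∑-indicator-≟ n w) ⟨
  ∑ n (λ x → indicator (x ≟ w)) + ∣ A ∣ + ∣ B ∣                ≡⟨ cong (_+ ∣ B ∣) (∑-distrib-+ n _ _) ⟨
  ∑ n (λ x → indicator (x ≟ w) + χ A x) + ∣ B ∣                ≡⟨ ∑-distrib-+ n _ _ ⟨
  ∑ n (λ x → indicator (x ≟ w) + χ A x + χ B x)                ≤⟨ ∑-mono-≤ n at-most-one ⟩
  ∑ n (λ _ → 1)                                                ≡⟨ trans (∑-const n 1) (*-identityʳ n) ⟩
  n                                                            ∎
  where
  open ≤-Reasoning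
  at-most-one : ∀ x → indicator (x ≟ w) + χ A x + χ B x ≤ 1
  at-most-one x with x ≟ w | x ∈? A | x ∈? B
  ... | yes refl | yes x∈A | _ = ⊥-elim (w∉A x∈A)
  ... | yes refl | no _ | yes x∈B = ⊥-elim (w∉B x∈B)
  ... | yes _ | no _ | no _ = ≤-refl
  ... | no _ | yes x∈A | yes x∈B = ⊥-elim (A#B (x∈A , x∈B))
  ... | no _ | yes _ | no _ = ≤-refl
  ... | no _ | no _ | yes _ = ≤-refl
  ... | no _ | no _ | no _ = z≤n

-- A pair in A × B is one non-edge {x, y} but is met both as (x, y) and as (y, x) in the
-- symmetrised sum, whence the factor 2.
∣A∣*∣B∣≤nonEdgeCount : ∀ {n} (G : Graph n) {A B : List (Fin n)} → Disjoint A B →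
  (∀ {x y} → x ∈ A → y ∈ B → adj G x y ≡ false) → ∣ A ∣ * ∣ B ∣ ≤ nonEdgeCount G
∣A∣*∣B∣≤nonEdgeCount {n} G {A} {B} A#B A≁B = *-cancelˡ-≤ 2 (begin
  2 * (∣ A ∣ * ∣ B ∣)                                     ≡⟨ double (∣ A ∣ * ∣ B ∣) ⟩
  ∣ A ∣ * ∣ B ∣ + ∣ A ∣ * ∣ B ∣                           ≡⟨ cong₂ _+_ (∑∑-product n (χ A) (χ B)) (trans (∑∑-transpose n _) (∑∑-product n (χ A) (χ B))) ⟨
  ∑∑ n (λ i j → χ A i * χ B j) + ∑∑ n (λ i j → χ A j * χ B i)  ≡⟨ ∑∑-distrib-+ n _ _ ⟨
  ∑∑ n (λ i j → χ A i * χ B j + χ A j * χ B i)            ≤⟨ ∑∑-mono-≤ n across ⟩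
  ∑∑ n (λ i j → q i j + q j i)                            ≡⟨ ∑∑-distrib-+ n _ _ ⟩
  nonEdgeCount G + ∑∑ n (λ i j → q j i)                   ≡⟨ cong (nonEdgeCount G +_) (∑∑-transpose n q) ⟩
  nonEdgeCount G + nonEdgeCount G                         ≡⟨ double (nonEdgeCount G) ⟨
  2 * nonEdgeCount G                                      ∎)
  where
  open ≤-Reasoning
  q = nonEdgeIndicator G
  double : ∀ m → 2 * m ≡ m + m
  double m = cong (m +_) (+-identityʳ m)
  across : ∀ i j → χ A i * χ B j + χ A j * χ B i ≤ q i j + q j i
  across i j = ≤-trans (≤-reflexive (≡-sym (cong₂ _+_ (indicator-× (i ∈? A) (j ∈? B)) (indicator-× (j ∈? A) (i ∈? B)))))
                       (cross-pair ((i ∈? A) ×-dec (j ∈? B)) ((j ∈? A) ×-dec (i ∈? B)))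
    where
    cross-pair : (p : Dec (i ∈ A × j ∈ B)) (p′ : Dec (j ∈ A × i ∈ B)) → indicator p + indicator p′ ≤ q i j + q j i
    cross-pair (yes (i∈A , j∈B)) (yes (j∈A , _)) = ⊥-elim (A#B (j∈A , j∈B))
    cross-pair (yes (i∈A , j∈B)) (no _) = nonEdgeIndicator-pair G (λ { refl → A#B (i∈A , j∈B) }) (A≁B i∈A j∈B)
    cross-pair (no _) (yes (j∈A , i∈B)) =
      ≤-trans (nonEdgeIndicator-pair G (λ { refl → A#B (j∈A , i∈B) }) (A≁B j∈A i∈B)) (≤-reflexive (+-comm (q j i) (q i j)))
    cross-pair (no _) (no _) = z≤n

module _ {n} (G : Graph n) (T : Subset n) where

  Reach-end∉ : ∀ {u v} → Reach G T u v → v ∉ₛ T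
  Reach-end∉ (here v∉T) = v∉T
  Reach-end∉ (step _ _ v∉T) = v∉T

  Reach-trans : ∀ {u w v} → Reach G T u w → Reach G T w v → Reach G T u v
  Reach-trans u⇝w (here _) = u⇝w
  Reach-trans u⇝w (step w⇝x x∼v v∉T) = step (Reach-trans u⇝w w⇝x) x∼v v∉T

  Reach-sym : ∀ {u v} → Reach G T u v → Reach G T v u
  Reach-sym (here u∉T) = here u∉T
  Reach-sym (step {x} {v} u⇝x x∼v v∉T) =
    Reach-trans (step (here v∉T) (trans (Graph.sym G v x) x∼v) (Reach-end∉ u⇝x)) (Reach-sym u⇝x)

  Reach-∅⇒Reach⊎meets : ∀ {u x} → Reach G ∅ u x → u ∉ₛ T → Reach G T u x ⊎ ∃ (_∈ₛ T)
  Reach-∅⇒Reach⊎meets (here _) u∉T = inj₁ (here u∉T)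
  Reach-∅⇒Reach⊎meets (step {v = x} u⇝w w∼x _) u∉T with Reach-∅⇒Reach⊎meets u⇝w u∉T | x ∈ₛ? T
  ... | inj₂ meets | _ = inj₂ meets
  ... | inj₁ _ | yes x∈T = inj₂ (x , x∈T)
  ... | inj₁ u⇝w′ | no x∉T = inj₁ (step u⇝w′ w∼x x∉T)

  separator-nonempty : Connected G → ∀ {u v} → u ∉ₛ T → ¬ Reach G T u v → ∃ (_∈ₛ T)
  separator-nonempty connected {u} {v} u∉T u↮v with Reach-∅⇒Reach⊎meets (connected u v) u∉T
  ... | inj₁ u⇝v = ⊥-elim (u↮v u⇝v)
  ... | inj₂ meets = meets

  ∈separator⇒∉component : ∀ {u w xs} → w ∈ₛ T → All (Reach G T u) xs → w ∉ xs
  ∈separator⇒∉component w∈T xs⊆ w∈xs = Reach-end∉ (lookup xs⊆ w∈xs) w∈T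

  module _ {u v} (u↮v : ¬ Reach G T u v) {A B : List (Fin n)}
           (A⊆ : All (Reach G T u) A) (B⊆ : All (Reach G T v) B) where

    components-disjoint : Disjoint A B
    components-disjoint (x∈A , x∈B) = u↮v (Reach-trans (lookup A⊆ x∈A) (Reach-sym (lookup B⊆ x∈B)))

    components-nonadjacent : ∀ {x y} → x ∈ A → y ∈ B → adj G x y ≡ false
    components-nonadjacent {x} {y} x∈A y∈B with adj G x y in x∼y
    ... | false = refl
    ... | true = ⊥-elim (u↮v (Reach-trans (step u⇝x x∼y (Reach-end∉ v⇝y)) (Reach-sym v⇝y)))
      where
      u⇝x = lookup A⊆ x∈A
      v⇝y = lookup B⊆ y∈B

order-bounds : ∀ g n → suc g + suc g < n → 3 ≤ n × g ≤ (n ∸ 3) / 2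
order-bounds g n 2[1+g]<n = m+n≤o⇒n≤o (g * 2) g*2+3≤n , (begin
  g              ≡⟨ m*n/n≡m g 2 ⟨
  g * 2 / 2      ≤⟨ /-monoˡ-≤ 2 (m+n≤o⇒m≤o∸n (g * 2) g*2+3≤n) ⟩
  (n ∸ 3) / 2    ∎)
  where
  open ≤-Reasoning
  rearrange : ∀ g → g * 2 + 3 ≡ suc (suc g + suc g)
  rearrange = solve-∀
  g*2+3≤n : g * 2 + 3 ≤ n
  g*2+3≤n = ≤-trans (≤-reflexive (rearrange g)) 2[1+g]<n

proposition1p3 : (g n : ℕ) (G : Graph n) → Connected G →
    Σ (Subset n) (λ S → IsRgCutset g G S) →
    (0 ≤ g × 3 ≤ n × g ≤ (n ∸ 3) / 2) × edgeCount G + (suc g) ^ 2 ≤ n C 2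
proposition1p3 g n G connected (T , (u , v , u∉T , v∉T , u↮v) , large)
  with large u u∉T | large v v∉T | separator-nonempty G T connected u∉T u↮v
... | A , lengthA≡1+g , unique-A , A⊆ | B , lengthB≡1+g , unique-B , B⊆ | w , w∈T =
  (z≤n , order-bounds g n order) , size
  where
  open ≤-Reasoning
  A#B = components-disjoint G T u↮v A⊆ B⊆
  g<∣A∣ : suc g ≤ ∣ A ∣
  g<∣A∣ = subst (_≤ ∣ A ∣) lengthA≡1+g (Unique⇒length≤∣∣ unique-A)
  g<∣B∣ : suc g ≤ ∣ B ∣
  g<∣B∣ = subst (_≤ ∣ B ∣) lengthB≡1+g (Unique⇒length≤∣∣ unique-B)
  order : suc g + suc g < n
  order = ≤-trans (s≤s (+-mono-≤ g<∣A∣ g<∣B∣))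
                  (∣A∣+∣B∣<n A#B (∈separator⇒∉component G T w∈T A⊆) (∈separator⇒∉component G T w∈T B⊆))
  size : edgeCount G + suc g ^ 2 ≤ n C 2
  size = begin
    edgeCount G + suc g ^ 2        ≡⟨ cong (λ k → edgeCount G + suc g * k) (*-identityʳ (suc g)) ⟩
    edgeCount G + suc g * suc g    ≤⟨ +-monoʳ-≤ (edgeCount G) (*-mono-≤ g<∣A∣ g<∣B∣) ⟩
    edgeCount G + ∣ A ∣ * ∣ B ∣    ≤⟨ +-monoʳ-≤ (edgeCount G) (∣A∣*∣B∣≤nonEdgeCount G A#B (components-nonadjacent G T u↮v A⊆ B⊆)) ⟩
    edgeCount G + nonEdgeCount G   ≡⟨ edgeCount+nonEdgeCount≡nC2 G ⟩
    n C 2                          ∎
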